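{- Let $s\ge1$ and let $G$ be a $1$-locally $s$-colourable graph on $n$ vertices. Then $\chi(G)\le\sqrt{2sn}$.
   Context: A graph $G$ is $1$-locally $s$-colourable if for every vertex $v$ the subgraph induced by the closed neighbourhood $N[v]$ has chromatic number at most $s$. -}

module Defs where

open import Level using (0ℓ)
open import Data.Nat using (ℕ)
open import Data.Fin using (Fin)
open import Data.Product using (Σ; _×_)
open import Data.Sum using (_⊎_)
open import Relation.Binary.PropositionalEquality using (_≡_; _≢_)
open import Relation.Nullary using (¬_; Dec)

record Graph (n : ℕ) : Set₁ where
  field
    Adj   : Fin n → Fin n → Set
    adj?  : (u v : Fin n) → Dec (Adj u v)
    sym   : ∀ {u v} → Adj u v → Adj v u
    irrefl : ∀ {u} → ¬ Adj u u
open Graph public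

ClosedNbhd : ∀ {n} → Graph n → Fin n → Fin n → Set
ClosedNbhd G v u = (u ≡ v) ⊎ Adj G v u

ProperColouring : ∀ {n} → Graph n → (k : ℕ) → (Fin n → Fin k) → Set
ProperColouring G k c = ∀ u w → Adj G u w → c u ≢ c w

Colourable : ∀ {n} → Graph n → ℕ → Set
Colourable {n} G k = Σ (Fin n → Fin k) (ProperColouring G k)

InducedNbhdColourable : ∀ {n} → Graph n → Fin n → ℕ → Set
InducedNbhdColourable {n} G v s =
  Σ ((u : Fin n) → ClosedNbhd G v u → Fin s) λ c →
    ∀ u w (pu : ClosedNbhd G v u) (pw : ClosedNbhd G v w) →
      Adj G u w → c u pu ≢ c w pw

LocallyColourable : ∀ {n} → Graph n → ℕ → Set
LocallyColourable G s = ∀ v → InducedNbhdColourable G v s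

{-# OPTIONS --safe #-}
module Submission where

-- Every list S of vertices with 2s|S| < (K + 1)² can be properly coloured with K colours, by
-- induction on |S|. Let v be the head of S. If N[v] ∩ S has at most K elements, colour the tail
-- and give v a colour missed by its fewer than K neighbours. Otherwise N[v] ∩ S gets s colours of
-- its own from local colourability, and since more than K vertices were removed, the remaining
-- r vertices satisfy 2sr < (K − s + 1)², so they take the other K − s colours. (If K < s, such a
-- large neighbourhood already gives (K + 1)² ≤ s|S|, which is impossible.) Taking K = ⌊√(2sn)⌋
-- and S the list of all vertices gives the theorem.

open import Defs
open import Data.Nat using (ℕ; _≤_; _*_)
open import Data.Product using (Σ; _×_)

open import Data.Nat using (zero; suc; _+_; _<_; z≤n; s≤s; _≤?_; _<?_)
open import Data.Nat.Properties hiding (_≟_)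
open import Data.Nat.Induction using (<-wellFounded)
open import Data.Nat.Tactic.RingSolver using (solve-∀)
open import Data.Fin using (Fin; toℕ; fromℕ<; _≟_)
open import Data.Fin.Properties using (¬∀⟶∃¬; injective⇒≤; toℕ-injective; toℕ<n; toℕ≤pred[n]; toℕ-fromℕ<)
open import Data.List using (List; []; _∷_; length; filter; map; lookup; allFin)
open import Data.List.Properties using (length-filter; filter-accept; length-map; length-tabulate)
open import Data.List.Relation.Unary.Any using (index; tail)
open import Data.List.Relation.Unary.Any.Properties using (lookup-index)
open import Data.List.Membership.Propositional using (_∈_; _∉_)
open import Data.List.Membership.Propositional.Properties using (∈-filter⁺; ∈-filter⁻; ∈-map⁺; ∈-allFin)
open import Data.List.Membership.DecPropositional Data.Nat._≟_ using (_∈?_)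
open import Data.Product using (_,_; proj₁; proj₂; ∃)
open import Data.Sum using (inj₁; inj₂)
open import Function using (_∘_)
open import Induction.WellFounded using (Acc; acc)
open import Relation.Binary.PropositionalEquality using (_≡_; _≢_; refl; cong; subst; trans) renaming (sym to ≡-sym)
open import Relation.Nullary using (yes; no; contradiction)
open import Relation.Nullary.Decidable using (_⊎-dec_)
open import Relation.Unary using (Pred; Decidable)
open import Relation.Unary.Properties using (∁?)

module _ {a p} {A : Set a} {P : Pred A p} (P? : Decidable P) where

  length-filter+length-filter-∁ : ∀ xs → length (filter P? xs) + length (filter (∁? P?) xs) ≡ length xs
  length-filter+length-filter-∁ [] = refl
  length-filter+length-filter-∁ (x ∷ xs) with P? x
  ... | yes _ = cong suc (length-filter+length-filter-∁ xs)
  ... | no  _ = trans (+-suc _ _) (cong suc (length-filter+length-filter-∁ xs))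

∃∉≤length : (xs : List ℕ) → ∃ λ i → i ≤ length xs × i ∉ xs
∃∉≤length xs =
  let j , j∉xs = ¬∀⟶∃¬ _ _ (λ j → toℕ j ∈? xs) (λ all∈ → 1+n≰n (injective⇒≤ (index-injective all∈)))
  in toℕ j , toℕ≤pred[n] j , j∉xs
  where
  index-injective : (all∈ : ∀ (j : Fin (suc (length xs))) → toℕ j ∈ xs) →
                    ∀ {i j} → index (all∈ i) ≡ index (all∈ j) → i ≡ j
  index-injective all∈ {i} {j} eq = toℕ-injective
    (trans (lookup-index (all∈ i)) (trans (cong (lookup xs) eq) (≡-sym (lookup-index (all∈ j)))))

∃-floor-sqrt : ∀ m → ∃ λ k → k * k ≤ m × m < suc k * suc k
∃-floor-sqrt zero = 0 , z≤n , s≤s z≤n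
∃-floor-sqrt (suc m) with ∃-floor-sqrt m
... | k , k²≤m , m<[1+k]² with suc k * suc k ≤? suc m
...   | yes [1+k]²≤1+m = suc k , [1+k]²≤1+m , ≤-<-trans m<[1+k]² (*-mono-< (n<1+n (suc k)) (n<1+n (suc k)))
...   | no  [1+k]²≰1+m = k , m≤n⇒m≤1+n k²≤m , ≰⇒> [1+k]²≰1+m

[1+k]²≤2*s*m : ∀ {k s m} → k < s → k < m → suc k * suc k ≤ 2 * s * m
[1+k]²≤2*s*m {k} {s} {m} k<s k<m = begin
  suc k * suc k ≤⟨ *-mono-≤ k<s k<m ⟩
  s * m         ≤⟨ m≤m+n (s * m) (s * m + 0) ⟩
  2 * (s * m)   ≡⟨ *-assoc 2 s m ⟨
  2 * s * m     ∎
  where open ≤-Reasoning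

-- 2s(s + k + 1) ≥ (s + k + 1)² − (k + 1)²: removing more than s + k vertices pays for s colours.
2*s*r<[1+k]² : ∀ s k t r → 2 * s * (t + r) < suc (s + k) * suc (s + k) → s + k < t → 2 * s * r < suc k * suc k
2*s*r<[1+k]² s k t r bound s+k<t = +-cancelʳ-< (2 * s * suc (s + k)) (2 * s * r) (suc k * suc k) (begin-strict
  2 * s * r + 2 * s * suc (s + k) ≤⟨ +-monoʳ-≤ (2 * s * r) (*-monoʳ-≤ (2 * s) s+k<t) ⟩
  2 * s * r + 2 * s * t           ≡⟨ +-comm (2 * s * r) (2 * s * t) ⟩
  2 * s * t + 2 * s * r           ≡⟨ *-distribˡ-+ (2 * s) t r ⟨
  2 * s * (t + r)                 <⟨ bound ⟩
  suc (s + k) * suc (s + k)       ≤⟨ m≤m+n _ (s * s) ⟩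
  suc (s + k) * suc (s + k) + s * s ≡⟨ identity s k ⟩
  suc k * suc k + 2 * s * suc (s + k) ∎)
  where
  open ≤-Reasoning
  identity : ∀ s k → suc (s + k) * suc (s + k) + s * s ≡ suc k * suc k + 2 * s * suc (s + k)
  identity = solve-∀

module _ {n} (G : Graph n) where

  closedNbhd? : (v : Fin n) → Decidable (ClosedNbhd G v)
  closedNbhd? v u = (u ≟ v) ⊎-dec adj? G v u

  -- Colours are naturals below k, so that the colouring is total even when k = 0.
  record ColouringOn (S : List (Fin n)) (k : ℕ) : Set where
    field
      colour   : Fin n → ℕ
      colour<k : ∀ {u} → u ∈ S → colour u < k
      proper   : ∀ {u w} → u ∈ S → w ∈ S → Adj G u w → colour u ≢ colour w

  open ColouringOn

  ColouringOn-[] : ∀ k → ColouringOn [] k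
  ColouringOn-[] k = record { colour = λ _ → 0 ; colour<k = λ () ; proper = λ () }

  ColouringOn-nbhd : ∀ {v s S} → InducedNbhdColourable G v s →
                     (∀ {u} → u ∈ S → ClosedNbhd G v u) → ColouringOn S s
  ColouringOn-nbhd {v} {s} {S} (c , c-proper) S⊆N[v] =
    record { colour = colour′ ; colour<k = colour′<s ; proper = colour′-proper }
    where
    colour′ : Fin n → ℕ
    colour′ u with closedNbhd? v u
    ... | yes u∈N[v] = toℕ (c u u∈N[v])
    ... | no  _      = 0
    colour′<s : ∀ {u} → u ∈ S → colour′ u < s
    colour′<s {u} u∈S with closedNbhd? v u
    ... | yes u∈N[v] = toℕ<n (c u u∈N[v])
    ... | no  u∉N[v] = contradiction (S⊆N[v] u∈S) u∉N[v]
    colour′-proper : ∀ {u w} → u ∈ S → w ∈ S → Adj G u w → colour′ u ≢ colour′ w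
    colour′-proper {u} {w} u∈S w∈S uw with closedNbhd? v u | closedNbhd? v w
    ... | yes u∈N[v] | yes w∈N[v] = c-proper u w u∈N[v] w∈N[v] uw ∘ toℕ-injective
    ... | no  u∉N[v] | _          = contradiction (S⊆N[v] u∈S) u∉N[v]
    ... | _          | no  w∉N[v] = contradiction (S⊆N[v] w∈S) w∉N[v]

  ColouringOn-filter : ∀ {p} {P : Pred (Fin n) p} (P? : Decidable P) {S a b} →
                       ColouringOn (filter P? S) a → ColouringOn (filter (∁? P?) S) b →
                       ColouringOn S (a + b)
  ColouringOn-filter {P = P} P? {S} {a} {b} c₁ c₂ =
    record { colour = colour′ ; colour<k = colour′<a+b ; proper = colour′-proper }
    where
    colour′ : Fin n → ℕ
    colour′ u with P? u
    ... | yes _ = colour c₁ u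
    ... | no  _ = a + colour c₂ u
    colour′<a+b : ∀ {u} → u ∈ S → colour′ u < a + b
    colour′<a+b {u} u∈S with P? u
    ... | yes Pu = ≤-trans (colour<k c₁ (∈-filter⁺ P? u∈S Pu)) (m≤m+n a b)
    ... | no ¬Pu = +-monoʳ-< a (colour<k c₂ (∈-filter⁺ (∁? P?) u∈S ¬Pu))
    low≢high : ∀ {u w} → u ∈ S → P u → a + colour c₂ w ≢ colour c₁ u
    low≢high u∈S Pu eq = <⇒≱ (colour<k c₁ (∈-filter⁺ P? u∈S Pu)) (subst (a ≤_) eq (m≤m+n a _))
    colour′-proper : ∀ {u w} → u ∈ S → w ∈ S → Adj G u w → colour′ u ≢ colour′ w
    colour′-proper {u} {w} u∈S w∈S uw with P? u | P? w
    ... | yes Pu  | yes Pw  = proper c₁ (∈-filter⁺ P? u∈S Pu) (∈-filter⁺ P? w∈S Pw) uw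
    ... | no  ¬Pu | no  ¬Pw = proper c₂ (∈-filter⁺ (∁? P?) u∈S ¬Pu) (∈-filter⁺ (∁? P?) w∈S ¬Pw) uw
                              ∘ +-cancelˡ-≡ a _ _
    ... | yes Pu  | no  _   = low≢high u∈S Pu ∘ ≡-sym
    ... | no  _   | yes Pw  = low≢high w∈S Pw

  ColouringOn-∷ : ∀ {v S k} → ColouringOn S k → length (filter (closedNbhd? v) S) < k →
                  ColouringOn (v ∷ S) k
  ColouringOn-∷ {v} {S} {k} c few =
    record { colour = colour′ ; colour<k = colour′<k ; proper = colour′-proper }
    where
    used : List ℕ
    used = map (colour c) (filter (closedNbhd? v) S)
    free : ∃ λ i → i ≤ length used × i ∉ used
    free = ∃∉≤length used
    i = proj₁ free
    i<k : i < k
    i<k = ≤-<-trans (subst (i ≤_) (length-map (colour c) (filter (closedNbhd? v) S)) (proj₁ (proj₂ free))) few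
    i≢nbr : ∀ {w} → w ∈ S → Adj G v w → i ≢ colour c w
    i≢nbr w∈S vw i≡cw = proj₂ (proj₂ free)
      (subst (_∈ used) (≡-sym i≡cw) (∈-map⁺ (colour c) (∈-filter⁺ (closedNbhd? v) w∈S (inj₂ vw))))
    colour′ : Fin n → ℕ
    colour′ u with u ≟ v
    ... | yes _ = i
    ... | no  _ = colour c u
    colour′<k : ∀ {u} → u ∈ v ∷ S → colour′ u < k
    colour′<k {u} u∈v∷S with u ≟ v
    ... | yes _   = i<k
    ... | no  u≢v = colour<k c (tail u≢v u∈v∷S)
    colour′-proper : ∀ {u w} → u ∈ v ∷ S → w ∈ v ∷ S → Adj G u w → colour′ u ≢ colour′ w
    colour′-proper {u} {w} u∈v∷S w∈v∷S uw with u ≟ v | w ≟ v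
    ... | yes refl | yes refl = contradiction uw (irrefl G)
    ... | yes refl | no  w≢v  = i≢nbr (tail w≢v w∈v∷S) uw
    ... | no  u≢v  | yes refl = i≢nbr (tail u≢v u∈v∷S) (sym G uw) ∘ ≡-sym
    ... | no  u≢v  | no  w≢v  = proper c (tail u≢v u∈v∷S) (tail w≢v w∈v∷S) uw

  ColouringOn⇒Colourable : ∀ {k} → ColouringOn (allFin n) k → Colourable G k
  ColouringOn⇒Colourable c =
    (λ u → fromℕ< (colour<k c (∈-allFin u))) ,
    (λ u w uw eq → proper c (∈-allFin u) (∈-allFin w) uw
      (trans (≡-sym (toℕ-fromℕ< _)) (trans (cong toℕ eq) (toℕ-fromℕ< _))))

module _ {n s} {G : Graph n} (locally : LocallyColourable G s) where

  colouringOn : (S : List (Fin n)) → Acc _<_ (length S) →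
                ∀ K → 2 * s * length S < suc K * suc K → ColouringOn G S K
  colouringOn []      _         K _     = ColouringOn-[] G K
  colouringOn (v ∷ S) (acc rec) K bound with K <? length (filter (closedNbhd? G v) (v ∷ S))
  ... | no small = ColouringOn-∷ G
        (colouringOn S (rec ≤-refl) K (≤-<-trans (*-monoʳ-≤ (2 * s) (n≤1+n _)) bound))
        (subst (λ T → length T ≤ K) (filter-accept (closedNbhd? G v) {xs = S} (inj₁ refl)) (≮⇒≥ small))
  ... | yes big with s ≤? K
  ...   | no  s≰K = contradiction bound
                      (≤⇒≯ ([1+k]²≤2*s*m (≰⇒> s≰K) (≤-trans big (length-filter (closedNbhd? G v) (v ∷ S)))))
  ...   | yes s≤K with m≤n⇒∃[o]m+o≡n s≤K
  ...     | k , refl = ColouringOn-filter G N?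
                         (ColouringOn-nbhd G (locally v) (proj₂ ∘ ∈-filter⁻ N? {xs = v ∷ S}))
                         (colouringOn R (rec R<S) k (2*s*r<[1+k]² s k t r bound′ big))
    where
    N? = closedNbhd? G v
    R = filter (∁? N?) (v ∷ S)
    t r : ℕ
    t = length (filter N? (v ∷ S))
    r = length R
    t+r≡∣S∣ : t + r ≡ length (v ∷ S)
    t+r≡∣S∣ = length-filter+length-filter-∁ N? (v ∷ S)
    R<S : r < length (v ∷ S)
    R<S = subst (r <_) t+r≡∣S∣ (m<n+m r (≤-trans (s≤s z≤n) big))
    bound′ : 2 * s * (t + r) < suc (s + k) * suc (s + k)
    bound′ = subst (λ m → 2 * s * m < suc (s + k) * suc (s + k)) (≡-sym t+r≡∣S∣) bound

lemma5p1 : (s n : ℕ) → 1 ≤ s → (G : Graph n) → LocallyColourable G s →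
    Σ ℕ (λ k → (k * k ≤ 2 * s * n) × Colourable G k)
lemma5p1 s n _ G locally =
  let K , K²≤2sn , 2sn<[1+K]² = ∃-floor-sqrt (2 * s * n)
      2s∣V∣<[1+K]² = subst (λ m → 2 * s * m < suc K * suc K) (≡-sym (length-tabulate {n = n} (λ u → u))) 2sn<[1+K]²
  in K , K²≤2sn ,
     ColouringOn⇒Colourable G (colouringOn locally (allFin n) (<-wellFounded _) K 2s∣V∣<[1+K]²)
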